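{- Let $n$ and $r$ be positive integers, and let $A=(A_1|A_2|\cdots|A_n)$ be a square matrix of order $n$ (over a field, e.g. the real numbers) with columns $A_1,\dots,A_n$. Define further column vectors recursively by $$A_{n+j}=\sum_{i=j}^{n+j-1}A_i,\qquad j=1,2,\dots,r,$$ and let $M(1,\dots,n-1,r+n)$ denote the determinant of the $n\times n$ matrix $(A_1|A_2|\cdots|A_{n-1}|A_{n+r})$. Then $$M(1,\dots,n-1,r+n)=F^{(n)}_r\cdot\det A,$$ where the sequence $F^{(n)}_1,F^{(n)}_2,\dots$ is defined by $F^{(n)}_k=2^{k-1}$ for $1\le k\le n$ and $F^{(n)}_k=F^{(n)}_{k-1}+F^{(n)}_{k-2}+\cdots+F^{(n)}_{k-n}$ for $k>n$.
   Context: Here $M(i_1,\dots,i_{n-1},r+n)$ denotes the $n\times n$ minor of the $n\times(n+r)$ matrix $(A_1|\cdots|A_{n+r})$ formed by the columns with indices $i_1<\dots<i_{n-1}<r+n$, in that order. In this statement the sequence $F^{(n)}_k$ is indexed so that $F^{(n)}_1=1,F^{(n)}_2=2,\dots,F^{(n)}_n=2^{n-1}$. -}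

module Defs where

open import Level using (_⊔_)
open import Data.Nat using (ℕ; zero; suc; _^_; _≤ᵇ_)
open import Data.Nat.ListAction using (sum)
open import Data.Fin using (Fin; zero; suc; toℕ; punchIn)
open import Data.List using (List; []; _∷_; take)
open import Data.Bool using (if_then_else_)
open import Data.Product using (∃)
open import Relation.Nullary using (¬_)
open import Algebra.Bundles using (CommutativeRing)

-- The sequence F^(n)_k (1-based k).  Fs n k = [F_k , F_{k-1} , … , F_1].
Fs : ℕ → ℕ → List ℕ
Fs n zero = []
Fs n (suc k) =
  (if suc k ≤ᵇ n then 2 ^ k else sum (take n (Fs n k))) ∷ Fs n k

-- F n k = F^(n)_k for k ≥ 1 (F n 0 = 0 is a junk value, never used).
F : ℕ → ℕ → ℕ
F n k with Fs n k
... | [] = 0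
... | x ∷ _ = x

module _ {c ℓ} (R : CommutativeRing c ℓ) where
  open CommutativeRing R hiding (zero)

  IsField : Set (c ⊔ ℓ)
  IsField = (¬ (1# ≈ 0#)) × (∀ x → ¬ (x ≈ 0#) → ∃ λ y → x * y ≈ 1#)
    where open import Data.Product using (_×_)

  fromℕ : ℕ → Carrier
  fromℕ zero = 0#
  fromℕ (suc k) = 1# + fromℕ k

  Σ< : ℕ → (ℕ → Carrier) → Carrier
  Σ< zero f = 0#
  Σ< (suc k) f = Σ< k f + f k

  ΣFin : ∀ {k} → (Fin k → Carrier) → Carrier
  ΣFin {zero} f = 0#
  ΣFin {suc k} f = f zero + ΣFin (λ i → f (suc i))

  sign : ℕ → Carrier
  sign zero = 1#
  sign (suc k) = - sign k

  -- A square matrix of order k given by its columns: M j i = entry in row i, column j.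
  -- Determinant by Laplace (cofactor) expansion along the first column.
  det : (k : ℕ) → (Fin k → Fin k → Carrier) → Carrier
  det zero M = 1#
  det (suc k) M =
    ΣFin (λ i → sign (toℕ i) * (M zero i * det k (λ j i' → M (suc j) (punchIn i i'))))

-- indices (0-based) of the columns of (A_1|…|A_{n-1}|A_{n+r}) where n = suc m:
-- column j ↦ j for j < m, last column ↦ m + r  (i.e. A_{n+r} in 1-based terms)
selectCol : (m r : ℕ) → Fin (suc m) → ℕ
selectCol zero r zero = r
selectCol (suc m) r zero = zero
selectCol (suc m) r (suc j) = suc (selectCol m r j)

module Submission where

-- For fixed A, D v = det (A_1|⋯|A_{n-1}|v) is linear in v, vanishes at v = A_i for i < n (two equal
-- columns) and equals det A at v = A_n.  Hence k ↦ D (A_k) and k ↦ G_k · det A both satisfy the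
-- n-term recurrence defining A_{n+1}, …, A_{n+r} and both start with 0, …, 0, det A, where G is
-- F^(n) continued to the left by F_0 = 1 and n - 1 zeros.  This continuation obeys the recurrence
-- already from F_1 on, because 1 + F_1 + ⋯ + F_{k-1} = 2^(k-1) for k ≤ n; so D (A_{n+r}) = F^(n)_r · det A.

open import Defs
open import Algebra.Bundles using (CommutativeRing)
open import Data.Vec.Functional using (Vector; updateAt)
open import Data.Fin using (Fin)

_[_]≔_ : ∀ {a} {A : Set a} {n} → Vector A n → Fin n → A → Vector A n
xs [ j ]≔ x = updateAt xs j (λ _ → x)

module ShiftedF where
  open import Data.Bool using (T; true; false; if_then_else_)
  open import Data.Unit using (tt)
  open import Data.Nat
  open import Data.Nat.Properties
  open import Data.Nat.ListAction using (sum)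
  open import Data.List using (List; []; _∷_; _++_; take; replicate; length; applyDownFrom)
  open import Function using (_∘_)
  open import Relation.Binary.PropositionalEquality
  open import Relation.Nullary using (¬_; contradiction; yes; no)

  -- Fshift n i k = F^(n)_(k-i), where F^(n) is continued to the left by F_0 = 1 and F_(-1) = F_(-2) = ⋯ = 0.
  Fshift : ℕ → ℕ → ℕ → ℕ
  Fshift n zero    zero    = 1
  Fshift n zero    (suc k) = F n (suc k)
  Fshift n (suc i) zero    = 0
  Fshift n (suc i) (suc k) = Fshift n i k

  Fshift-< : ∀ n {i k} → k < i → Fshift n i k ≡ 0
  Fshift-< n {suc i} {zero}  _         = refl
  Fshift-< n {suc i} {suc k} (s≤s k<i) = Fshift-< n k<i

  Fshift-self : ∀ n i → Fshift n i i ≡ 1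
  Fshift-self n zero    = refl
  Fshift-self n (suc i) = Fshift-self n i

  Fshift-+ : ∀ n i k → Fshift n i (i + k) ≡ Fshift n 0 k
  Fshift-+ n zero    k = refl
  Fshift-+ n (suc i) k = Fshift-+ n i k

  length-Fs : ∀ n j → length (Fs n j) ≡ j
  length-Fs n zero    = refl
  length-Fs n (suc j) = cong suc (length-Fs n j)

  F-initial : ∀ {n j} → suc j ≤ n → F n (suc j) ≡ 2 ^ j
  F-initial {n} {j} j<n = if-true (suc j ≤ᵇ n) (≤⇒≤ᵇ j<n)
    where
    if-true : ∀ b → T b → (if b then 2 ^ j else sum (take n (Fs n j))) ≡ 2 ^ j
    if-true true _ = refl

  F-recurrence : ∀ {n j} → n ≤ j → F n (suc j) ≡ sum (take n (Fs n j))
  F-recurrence {n} {j} n≤j = if-false (suc j ≤ᵇ n) (λ j<n → <⇒≱ (≤ᵇ⇒≤ (suc j) n j<n) n≤j)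
    where
    if-false : ∀ b → ¬ T b → (if b then 2 ^ j else sum (take n (Fs n j))) ≡ sum (take n (Fs n j))
    if-false false _ = refl
    if-false true  ¬t = contradiction tt ¬t

  sum-Fs : ∀ n j → j ≤ n → sum (Fs n j) + 1 ≡ 2 ^ j
  sum-Fs n zero    _   = refl
  sum-Fs n (suc j) j<n = begin
    F n (suc j) + sum (Fs n j) + 1   ≡⟨ cong (λ x → x + sum (Fs n j) + 1) (F-initial j<n) ⟩
    2 ^ j + sum (Fs n j) + 1         ≡⟨ +-assoc (2 ^ j) _ 1 ⟩
    2 ^ j + (sum (Fs n j) + 1)       ≡⟨ cong (2 ^ j +_) (sum-Fs n j (<⇒≤ j<n)) ⟩
    2 ^ j + 2 ^ j                    ≡⟨ cong (2 ^ j +_) (+-identityʳ (2 ^ j)) ⟨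
    2 ^ suc j                        ∎
    where open ≡-Reasoning

  take-++ˡ : ∀ k (xs ys : List ℕ) → k ≤ length xs → take k (xs ++ ys) ≡ take k xs
  take-++ˡ zero    xs       ys _         = refl
  take-++ˡ (suc k) (x ∷ xs) ys (s≤s k≤l) = cong (x ∷_) (take-++ˡ k xs ys k≤l)

  sum-take-replicate-0 : ∀ k b → sum (take k (replicate b 0)) ≡ 0
  sum-take-replicate-0 zero    b       = refl
  sum-take-replicate-0 (suc k) zero    = refl
  sum-take-replicate-0 (suc k) (suc b) = sum-take-replicate-0 k b

  sum-take-++-unit : ∀ (xs : List ℕ) k b → length xs ≤ k →
                     sum (take (suc k) (xs ++ 1 ∷ replicate b 0)) ≡ sum xs + 1
  sum-take-++-unit []       k       b _         = cong suc (sum-take-replicate-0 k b)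
  sum-take-++-unit (x ∷ xs) (suc k) b (s≤s l≤k) =
    trans (cong (x +_) (sum-take-++-unit xs k b l≤k)) (sym (+-assoc x _ 1))

  F-window : ∀ m j → F (suc m) (suc j) ≡ sum (take (suc m) (Fs (suc m) j ++ 1 ∷ replicate m 0))
  F-window m j with j ≤? m
  ... | yes j≤m = begin
    F (suc m) (suc j)                                        ≡⟨ F-initial (s≤s j≤m) ⟩
    2 ^ j                                                    ≡⟨ sum-Fs (suc m) j (m≤n⇒m≤1+n j≤m) ⟨
    sum (Fs (suc m) j) + 1                                   ≡⟨ sum-take-++-unit (Fs (suc m) j) m m length≤m ⟨
    sum (take (suc m) (Fs (suc m) j ++ 1 ∷ replicate m 0))  ∎
    where
    open ≡-Reasoning
    length≤m = ≤-trans (≤-reflexive (length-Fs (suc m) j)) j≤m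
  ... | no j≰m = trans (F-recurrence m<j)
    (cong sum (sym (take-++ˡ (suc m) (Fs (suc m) j) _ (≤-trans m<j (≤-reflexive (sym (length-Fs (suc m) j)))))))
    where m<j = ≰⇒> j≰m

  applyDownFrom-zeros : ∀ (f : ℕ → ℕ) k → (∀ {t} → t < k → f t ≡ 0) → applyDownFrom f k ≡ replicate k 0
  applyDownFrom-zeros f zero    _  = refl
  applyDownFrom-zeros f (suc k) f0 = cong₂ _∷_ (f0 ≤-refl) (applyDownFrom-zeros f k (f0 ∘ m≤n⇒m≤1+n))

  Fshift-beyond : ∀ m j → Fshift (suc m) m (j + suc m) ≡ F (suc m) (suc j)
  Fshift-beyond m j = trans (cong (Fshift (suc m) m) (trans (+-comm j (suc m)) (sym (+-suc m j))))
                            (Fshift-+ (suc m) m (suc j))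

  applyDownFrom-Fshift : ∀ m j → applyDownFrom (Fshift (suc m) m) (j + suc m) ≡ Fs (suc m) j ++ 1 ∷ replicate m 0
  applyDownFrom-Fshift m zero    = cong₂ _∷_ (Fshift-self (suc m) m) (applyDownFrom-zeros _ m (Fshift-< (suc m)))
  applyDownFrom-Fshift m (suc j) = cong₂ _∷_ (Fshift-beyond m j) (applyDownFrom-Fshift m j)

  Fshift-recurrence : ∀ m j → let G = Fshift (suc m) m in
                      G (suc m + j) ≡ sum (take (suc m) (applyDownFrom G (suc m + j)))
  Fshift-recurrence m j = begin
    G (suc m + j)                                            ≡⟨ cong G (+-comm (suc m) j) ⟩
    G (j + suc m)                                            ≡⟨ Fshift-beyond m j ⟩
    F (suc m) (suc j)                                        ≡⟨ F-window m j ⟩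
    sum (take (suc m) (Fs (suc m) j ++ 1 ∷ replicate m 0))  ≡⟨ cong (sum ∘ take (suc m)) (applyDownFrom-Fshift m j) ⟨
    sum (take (suc m) (applyDownFrom G (j + suc m)))         ≡⟨ cong (λ k → sum (take (suc m) (applyDownFrom G k))) (+-comm j (suc m)) ⟩
    sum (take (suc m) (applyDownFrom G (suc m + j)))         ∎
    where
    open ≡-Reasoning
    G = Fshift (suc m) m

module Determinant {c ℓ} (K : CommutativeRing c ℓ) where
  open import Data.Nat using (ℕ; zero; suc; s≤s; z≤n)
  open import Data.Fin using (Fin; zero; suc; toℕ; punchIn; _<_)
  open import Data.Fin.Properties using (<⇒≢)
  open import Data.Product using (_×_; _,_; proj₁; proj₂; uncurry)
  import Data.Product as Product
  open import Data.Vec.Functional using (Vector; _∷_; tail; removeAt; zipWith; map)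
  open import Data.Vec.Functional.Properties
    using (map-updateAt-local; updateAt-updates; updateAt-minimal)
  open import Function using (_∘_)
  open import Relation.Binary.PropositionalEquality as ≡ using (_≡_)
  open CommutativeRing K hiding (zero)
  open import Algebra.Properties.CommutativeSemigroup *-commutativeSemigroup using (x∙yz≈y∙xz)
  open import Algebra.Properties.CommutativeSemigroup +-commutativeSemigroup
    renaming (interchange to +-interchange) using ()
  open import Algebra.Properties.Group +-group using (⁻¹-involutive; inverseˡ-unique; ε⁻¹≈ε)
  open import Algebra.Properties.Ring ring using (-‿distribˡ-*; -‿distribʳ-*)
  open import Relation.Binary.Reasoning.Setoid setoid

  Matrix : ℕ → Set c
  Matrix k = Vector (Vector Carrier k) k

  Det : ∀ {k} → Matrix k → Carrier
  Det {k} = det K k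

  minor : ∀ {k} → Matrix (suc k) → Fin (suc k) → Matrix k
  minor M i = map (λ v → removeAt v i) (tail M)

  sgn : ∀ {k} → Fin k → Carrier
  sgn i = sign K (toℕ i)

  Σ± : ∀ {k} → (Fin k → Carrier) → Carrier
  Σ± t = ΣFin K (λ i → sgn i * t i)

  ΣFin-cong : ∀ {k} {f g : Fin k → Carrier} → (∀ i → f i ≈ g i) → ΣFin K f ≈ ΣFin K g
  ΣFin-cong {zero}  f≈g = refl
  ΣFin-cong {suc k} f≈g = +-cong (f≈g zero) (ΣFin-cong (f≈g ∘ suc))

  ΣFin-0 : ∀ {k} {f : Fin k → Carrier} → (∀ i → f i ≈ 0#) → ΣFin K f ≈ 0#
  ΣFin-0 {zero}  f≈0 = refl
  ΣFin-0 {suc k} f≈0 = trans (+-cong (f≈0 zero) (ΣFin-0 (f≈0 ∘ suc))) (+-identityʳ 0#)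

  ΣFin-+ : ∀ {k} (f g : Fin k → Carrier) → ΣFin K (λ i → f i + g i) ≈ ΣFin K f + ΣFin K g
  ΣFin-+ {zero}  f g = sym (+-identityʳ 0#)
  ΣFin-+ {suc k} f g = trans (+-congˡ (ΣFin-+ (f ∘ suc) (g ∘ suc))) (+-interchange _ _ _ _)

  *-ΣFin : ∀ {k} a (f : Fin k → Carrier) → a * ΣFin K f ≈ ΣFin K (λ i → a * f i)
  *-ΣFin {zero}  a f = zeroʳ a
  *-ΣFin {suc k} a f = trans (distribˡ a _ _) (+-congˡ (*-ΣFin a (f ∘ suc)))

  Σ±-cong : ∀ {k} {t u : Fin k → Carrier} → (∀ i → t i ≈ u i) → Σ± t ≈ Σ± u
  Σ±-cong t≈u = ΣFin-cong (λ i → *-congˡ (t≈u i))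

  Σ±-+ : ∀ {k} {t u w : Fin k → Carrier} → (∀ i → t i ≈ u i + w i) → Σ± t ≈ Σ± u + Σ± w
  Σ±-+ {u = u} {w} t≈u+w =
    trans (ΣFin-cong (λ i → trans (*-congˡ (t≈u+w i)) (distribˡ _ _ _))) (ΣFin-+ (λ i → sgn i * u i) (λ i → sgn i * w i))

  Σ±-* : ∀ {k} {t u : Fin k → Carrier} a → (∀ i → t i ≈ a * u i) → Σ± t ≈ a * Σ± u
  Σ±-* {u = u} a t≈au =
    trans (ΣFin-cong (λ i → trans (*-congˡ (t≈au i)) (x∙yz≈y∙xz _ a _))) (sym (*-ΣFin a (λ i → sgn i * u i)))

  Σ±-0 : ∀ {k} {t : Fin k → Carrier} → (∀ i → t i ≈ 0#) → Σ± t ≈ 0#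
  Σ±-0 t≈0 = ΣFin-0 (λ i → trans (*-congˡ (t≈0 i)) (zeroʳ _))

  det-cong : ∀ {k} {M N : Matrix k} → (∀ j i → M j i ≈ N j i) → Det M ≈ Det N
  det-cong {zero}  M≈N = refl
  det-cong {suc k} M≈N = Σ±-cong (λ i → *-cong (M≈N zero i) (det-cong (λ j i′ → M≈N (suc j) (punchIn i i′))))

  ≔-cong : ∀ {h k} (M : Vector (Vector Carrier h) k) j {v w : Vector Carrier h} → (∀ i → v i ≈ w i) →
           ∀ j′ i → (M [ j ]≔ v) j′ i ≈ (M [ j ]≔ w) j′ i
  ≔-cong M zero    v≈w zero     i = v≈w i
  ≔-cong M zero    v≈w (suc j′) i = refl
  ≔-cong M (suc j) v≈w zero     i = refl
  ≔-cong M (suc j) v≈w (suc j′) i = ≔-cong (tail M) j v≈w j′ i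

  det-≔-cong : ∀ {k} (M : Matrix k) j {v w : Vector Carrier k} → (∀ i → v i ≈ w i) →
               Det (M [ j ]≔ v) ≈ Det (M [ j ]≔ w)
  det-≔-cong M j v≈w = det-cong (≔-cong M j v≈w)

  det-minor-≔ : ∀ {k} (M : Matrix (suc k)) j v i →
                Det (minor (M [ suc j ]≔ v) i) ≈ Det (minor M i [ j ]≔ removeAt v i)
  det-minor-≔ M j v i = det-cong (λ j′ i′ → reflexive (≡.cong-app (minor-≔ j′) i′))
    where
    minor-≔ = map-updateAt-local {f = λ c → removeAt c i} {g = λ _ → v} (tail M) j ≡.refl

  det-additive : ∀ {k} (M : Matrix k) j (v w : Vector Carrier k) →
                 Det (M [ j ]≔ zipWith _+_ v w) ≈ Det (M [ j ]≔ v) + Det (M [ j ]≔ w)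
  det-additive {suc k} M zero    v w = Σ±-+ (λ i → distribʳ (Det (minor M i)) (v i) (w i))
  det-additive {suc k} M (suc j) v w = Σ±-+ (λ i → begin
    M zero i * Det (minor (M [ suc j ]≔ zipWith _+_ v w) i)
      ≈⟨ *-congˡ (trans (det-minor-≔ M j _ i) (det-additive (minor M i) j _ _)) ⟩
    M zero i * (Det (minor M i [ j ]≔ removeAt v i) + Det (minor M i [ j ]≔ removeAt w i))
      ≈⟨ distribˡ _ _ _ ⟩
    M zero i * Det (minor M i [ j ]≔ removeAt v i) + M zero i * Det (minor M i [ j ]≔ removeAt w i)
      ≈⟨ +-cong (*-congˡ (det-minor-≔ M j v i)) (*-congˡ (det-minor-≔ M j w i)) ⟨
    M zero i * Det (minor (M [ suc j ]≔ v) i) + M zero i * Det (minor (M [ suc j ]≔ w) i) ∎)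

  det-homogeneous : ∀ {k} (M : Matrix k) j a (v : Vector Carrier k) →
                    Det (M [ j ]≔ map (a *_) v) ≈ a * Det (M [ j ]≔ v)
  det-homogeneous {suc k} M zero    a v = Σ±-* a (λ i → *-assoc a (v i) (Det (minor M i)))
  det-homogeneous {suc k} M (suc j) a v = Σ±-* a (λ i → begin
    M zero i * Det (minor (M [ suc j ]≔ map (a *_) v) i)
      ≈⟨ *-congˡ (trans (det-minor-≔ M j _ i) (det-homogeneous (minor M i) j a _)) ⟩
    M zero i * (a * Det (minor M i [ j ]≔ removeAt v i))
      ≈⟨ x∙yz≈y∙xz _ a _ ⟩
    a * (M zero i * Det (minor M i [ j ]≔ removeAt v i))
      ≈⟨ *-congˡ (*-congˡ (det-minor-≔ M j v i)) ⟨
    a * (M zero i * Det (minor (M [ suc j ]≔ v) i)) ∎)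

  det-≔-0 : ∀ {k} (M : Matrix k) j → Det (M [ j ]≔ (λ _ → 0#)) ≈ 0#
  det-≔-0 M j = begin
    Det (M [ j ]≔ (λ _ → 0#))                  ≈⟨ det-≔-cong M j (λ _ → sym (zeroˡ 0#)) ⟩
    Det (M [ j ]≔ map (0# *_) (λ _ → 0#))      ≈⟨ det-homogeneous M j 0# _ ⟩
    0# * Det (M [ j ]≔ (λ _ → 0#))             ≈⟨ zeroˡ _ ⟩
    0#                                          ∎

  det-Σ< : ∀ {k} (M : Matrix k) j n (W : ℕ → Vector Carrier k) →
           Det (M [ j ]≔ (λ i → Σ< K n (λ t → W t i))) ≈ Σ< K n (λ t → Det (M [ j ]≔ W t))
  det-Σ< M j zero    W = det-≔-0 M j
  det-Σ< M j (suc n) W = trans (det-additive M j _ (W n)) (+-congʳ (det-Σ< M j n W))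

  -- (a , b) stands for the ordered pair of distinct indices (a , punchIn a b); exchange swaps the two.
  exchange : ∀ {k} → Fin (suc (suc k)) → Fin (suc k) → Fin (suc (suc k)) × Fin (suc k)
  exchange zero            b       = suc b , zero
  exchange (suc a)         zero    = zero , a
  exchange {suc k} (suc a) (suc b) = Product.map suc suc (exchange a b)

  exchange-fst : ∀ {k} (a : Fin (suc (suc k))) b → proj₁ (exchange a b) ≡ punchIn a b
  exchange-fst zero            b       = ≡.refl
  exchange-fst (suc a)         zero    = ≡.refl
  exchange-fst {suc k} (suc a) (suc b) = ≡.cong suc (exchange-fst a b)

  exchange-snd : ∀ {k} (a : Fin (suc (suc k))) b → uncurry punchIn (exchange a b) ≡ a
  exchange-snd zero            b       = ≡.refl
  exchange-snd (suc a)         zero    = ≡.refl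
  exchange-snd {suc k} (suc a) (suc b) = ≡.cong suc (exchange-snd a b)

  exchange-punchIn : ∀ {k} (a : Fin (suc (suc k))) b i →
                     uncurry (λ a′ b′ → punchIn a′ (punchIn b′ i)) (exchange a b) ≡ punchIn a (punchIn b i)
  exchange-punchIn zero            b       i       = ≡.refl
  exchange-punchIn (suc a)         zero    i       = ≡.refl
  exchange-punchIn {suc k} (suc a) (suc b) zero    = ≡.refl
  exchange-punchIn {suc k} (suc a) (suc b) (suc i) = ≡.cong suc (exchange-punchIn a b i)

  -x*-y≈x*y : ∀ x y → - x * - y ≈ x * y
  -x*-y≈x*y x y = begin
    - x * - y      ≈⟨ -‿distribˡ-* x (- y) ⟨
    - (x * - y)    ≈⟨ -‿cong (-‿distribʳ-* x y) ⟨
    - (- (x * y))  ≈⟨ ⁻¹-involutive (x * y) ⟩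
    x * y          ∎

  exchange-sgn : ∀ {k} (a : Fin (suc (suc k))) b →
                 sgn a * sgn b ≈ - uncurry (λ a′ b′ → sgn a′ * sgn b′) (exchange a b)
  exchange-sgn zero b = begin
    1# * sgn b          ≈⟨ *-identityˡ _ ⟩
    sgn b               ≈⟨ ⁻¹-involutive _ ⟨
    - (- sgn b)         ≈⟨ -‿cong (*-identityʳ _) ⟨
    - (- sgn b * 1#)    ∎
  exchange-sgn (suc a) zero = begin
    - sgn a * 1#        ≈⟨ *-identityʳ _ ⟩
    - sgn a             ≈⟨ -‿cong (*-identityˡ _) ⟨
    - (1# * sgn a)      ∎
  exchange-sgn {suc k} (suc a) (suc b) = begin
    - sgn a * - sgn b   ≈⟨ -x*-y≈x*y _ _ ⟩
    sgn a * sgn b       ≈⟨ exchange-sgn a b ⟩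
    - (sgn a′ * sgn b′) ≈⟨ -‿cong (-x*-y≈x*y _ _) ⟨
    - (- sgn a′ * - sgn b′) ∎
    where
    a′ = proj₁ (exchange a b)
    b′ = proj₂ (exchange a b)

  ΣΣ-antisymmetric : ∀ {k} (g : Fin (suc (suc k)) → Fin (suc k) → Carrier) →
                     (∀ a b → g a b ≈ - uncurry g (exchange a b)) → ΣFin K (λ a → ΣFin K (g a)) ≈ 0#
  ΣΣ-interior-antisymmetric : ∀ k (g : Fin (suc (suc k)) → Fin (suc k) → Carrier) →
                              (∀ a b → g a b ≈ - uncurry g (exchange a b)) →
                              ΣFin K (λ a → ΣFin K (λ b → g (suc a) (suc b))) ≈ 0#

  ΣΣ-antisymmetric {k} g g≈-g = begin
    ΣFin K (g zero) + ΣFin K (λ a → g (suc a) zero + ΣFin K (λ b → g (suc a) (suc b)))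
      ≈⟨ +-congˡ (ΣFin-+ (λ a → g (suc a) zero) (λ a → ΣFin K (λ b → g (suc a) (suc b)))) ⟩
    ΣFin K (g zero) + (ΣFin K (λ a → g (suc a) zero) + ΣFin K (λ a → ΣFin K (λ b → g (suc a) (suc b))))
      ≈⟨ +-assoc _ _ _ ⟨
    (ΣFin K (g zero) + ΣFin K (λ a → g (suc a) zero)) + ΣFin K (λ a → ΣFin K (λ b → g (suc a) (suc b)))
      ≈⟨ +-cong border (ΣΣ-interior-antisymmetric k g g≈-g) ⟩
    0# + 0#
      ≈⟨ +-identityʳ 0# ⟩
    0# ∎
    where
    border : ΣFin K (g zero) + ΣFin K (λ a → g (suc a) zero) ≈ 0#
    border = trans (sym (ΣFin-+ (g zero) (λ a → g (suc a) zero)))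
                   (ΣFin-0 (λ b → trans (+-congʳ (g≈-g zero b)) (-‿inverseˡ _)))

  ΣΣ-interior-antisymmetric zero    g g≈-g = +-identityʳ 0#
  ΣΣ-interior-antisymmetric (suc k) g g≈-g =
    ΣΣ-antisymmetric (λ a b → g (suc a) (suc b)) (λ a b → g≈-g (suc a) (suc b))

  -- In the expansion along the two equal columns the terms of (a , b) and exchange a b cancel.
  det-duplicate₀₁ : ∀ {k} (x : Vector Carrier (suc (suc k))) R → Det (x ∷ x ∷ R) ≈ 0#
  det-duplicate₀₁ {k} x R = trans (ΣFin-cong expand) (ΣΣ-antisymmetric g g≈-g)
    where
    D : Fin (suc (suc k)) → Fin (suc k) → Carrier
    D a b = Det (minor (minor (x ∷ x ∷ R) a) b)

    g : Fin (suc (suc k)) → Fin (suc k) → Carrier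
    g a b = (sgn a * sgn b) * ((x a * x (punchIn a b)) * D a b)

    regroup : ∀ s y t z d → s * (y * (t * (z * d))) ≈ (s * t) * ((y * z) * d)
    regroup s y t z d = begin
      s * (y * (t * (z * d)))  ≈⟨ *-congˡ (x∙yz≈y∙xz y t _) ⟩
      s * (t * (y * (z * d)))  ≈⟨ *-assoc s t _ ⟨
      (s * t) * (y * (z * d))  ≈⟨ *-congˡ (*-assoc y z d) ⟨
      (s * t) * ((y * z) * d)  ∎

    expand : ∀ a → sgn a * (x a * Σ± (λ b → x (punchIn a b) * D a b)) ≈ ΣFin K (g a)
    expand a = begin
      sgn a * (x a * Σ± (λ b → x (punchIn a b) * D a b))
        ≈⟨ *-congˡ (*-ΣFin (x a) (λ b → sgn b * (x (punchIn a b) * D a b))) ⟩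
      sgn a * ΣFin K (λ b → x a * (sgn b * (x (punchIn a b) * D a b)))
        ≈⟨ *-ΣFin (sgn a) (λ b → x a * (sgn b * (x (punchIn a b) * D a b))) ⟩
      ΣFin K (λ b → sgn a * (x a * (sgn b * (x (punchIn a b) * D a b))))
        ≈⟨ ΣFin-cong (λ b → regroup (sgn a) (x a) (sgn b) (x (punchIn a b)) (D a b)) ⟩
      ΣFin K (g a) ∎

    g≈-g : ∀ a b → g a b ≈ - uncurry g (exchange a b)
    g≈-g a b = begin
      (sgn a * sgn b) * W        ≈⟨ *-congʳ (exchange-sgn a b) ⟩
      - (sgn a′ * sgn b′) * W    ≈⟨ -‿distribˡ-* _ W ⟨
      - ((sgn a′ * sgn b′) * W)  ≈⟨ -‿cong (*-congˡ W′≈W) ⟨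
      - g a′ b′                  ∎
      where
      a′ = proj₁ (exchange a b)
      b′ = proj₂ (exchange a b)
      W = (x a * x (punchIn a b)) * D a b
      W′≈W : (x a′ * x (punchIn a′ b′)) * D a′ b′ ≈ W
      W′≈W = *-cong
        (trans (reflexive (≡.cong₂ (λ c d → x c * x d) (exchange-fst a b) (exchange-snd a b))) (*-comm _ _))
        (det-cong (λ j i → reflexive (≡.cong (R j) (exchange-punchIn a b i))))

  det-swap₀₁ : ∀ {k} (x y : Vector Carrier (suc (suc k))) R → Det (y ∷ x ∷ R) ≈ - Det (x ∷ y ∷ R)
  det-swap₀₁ x y R = inverseˡ-unique _ _ (begin
    d y x + d x y                      ≈⟨ +-comm _ _ ⟩
    d x y + d y x                      ≈⟨ +-cong (+-identityˡ _) (+-identityʳ _) ⟨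
    (0# + d x y) + (d y x + 0#)        ≈⟨ +-cong (+-congʳ (det-duplicate₀₁ x R)) (+-congˡ (det-duplicate₀₁ y R)) ⟨
    (d x x + d x y) + (d y x + d y y)  ≈⟨ +-cong (det-additive (x ∷ s ∷ R) (suc zero) x y)
                                                 (det-additive (y ∷ s ∷ R) (suc zero) x y) ⟨
    d x s + d y s                      ≈⟨ det-additive (s ∷ s ∷ R) zero x y ⟨
    d s s                              ≈⟨ det-duplicate₀₁ s R ⟩
    0#                                 ∎)
    where
    s = zipWith _+_ x y
    d : Vector Carrier _ → Vector Carrier _ → Carrier
    d u v = Det (u ∷ v ∷ R)

  det-minors-0 : ∀ {k} (M : Matrix (suc k)) → (∀ i → Det (minor M i) ≈ 0#) → Det M ≈ 0#
  det-minors-0 M minors≈0 = Σ±-0 (λ i → trans (*-congˡ (minors≈0 i)) (zeroʳ (M zero i)))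

  det-equal-columns : ∀ {k} (M : Matrix k) {p q : Fin k} → p < q → (∀ i → M p i ≈ M q i) → Det M ≈ 0#
  det-equal-columns {suc (suc k)} M {zero} {suc zero} _ M₀≈M₁ = begin
    Det M                                   ≈⟨ det-cong {M = M} {N = M zero ∷ M zero ∷ tail (tail M)}
                                                 (λ { zero i → refl ; (suc zero) i → sym (M₀≈M₁ i)
                                                           ; (suc (suc j)) i → refl }) ⟩
    Det (M zero ∷ M zero ∷ tail (tail M))   ≈⟨ det-duplicate₀₁ (M zero) (tail (tail M)) ⟩
    0#                                      ∎
  det-equal-columns {suc (suc k)} M {zero} {suc (suc q)} _ M₀≈Mq = begin
    Det M                                   ≈⟨ det-cong {M = M} {N = M zero ∷ M (suc zero) ∷ R}
                                                 (λ { zero i → refl ; (suc zero) i → refl ; (suc (suc j)) i → refl }) ⟩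
    Det (M zero ∷ M (suc zero) ∷ R)         ≈⟨ det-swap₀₁ (M (suc zero)) (M zero) R ⟩
    - Det (M (suc zero) ∷ M zero ∷ R)       ≈⟨ -‿cong (det-minors-0 N λ i →
                                                 det-equal-columns (minor N i) {zero} {suc q} (s≤s z≤n) (M₀≈Mq ∘ punchIn i)) ⟩
    - 0#                                    ≈⟨ ε⁻¹≈ε ⟩
    0#                                      ∎
    where
    R = tail (tail M)
    N = M (suc zero) ∷ M zero ∷ R
  det-equal-columns {suc k} M {suc p} {suc q} (s≤s p<q) Mp≈Mq =
    det-minors-0 M (λ i → det-equal-columns (minor M i) p<q (Mp≈Mq ∘ punchIn i))

  det-≔-copy : ∀ {k} (M : Matrix k) {p q} → p < q → Det (M [ q ]≔ M p) ≈ 0#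
  det-≔-copy M {p} {q} p<q = det-equal-columns (M [ q ]≔ M p) p<q
    (λ i → reflexive (≡.cong-app (≡.trans (updateAt-minimal p q M (<⇒≢ p<q)) (≡.sym (updateAt-updates q M))) i))

module Recurrence {c ℓ} (K : CommutativeRing c ℓ) where
  open import Data.Nat using (ℕ; zero; suc; _<?_; s≤s)
  import Data.Nat as ℕ
  open import Data.Nat.Properties
    using (≤-refl; m≤n⇒m≤1+n; ≮⇒≥; m≤n⇒∃[o]m+o≡n; +-cancelˡ-<; +-monoʳ-<; <-≤-trans; <⇒≤)
    renaming (+-comm to ℕ-+-comm)
  open import Data.Nat.Induction using (<-rec)
  open import Data.Nat.ListAction using (sum)
  open import Data.List using (take; applyDownFrom)
  open import Data.Product using (_,_)
  open import Relation.Nullary using (yes; no)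
  open import Relation.Binary.PropositionalEquality as ≡ using (_≡_)
  open CommutativeRing K hiding (zero)
  open import Relation.Binary.Reasoning.Setoid setoid

  Σ<-cong : ∀ n {f g : ℕ → Carrier} → (∀ t → t ℕ.< n → f t ≈ g t) → Σ< K n f ≈ Σ< K n g
  Σ<-cong zero    f≈g = refl
  Σ<-cong (suc n) f≈g = +-cong (Σ<-cong n (λ t t<n → f≈g t (m≤n⇒m≤1+n t<n))) (f≈g n ≤-refl)

  recurrence-agree : ∀ n r (u v : ℕ → Carrier) →
    (∀ j → j ℕ.< r → u (n ℕ.+ j) ≈ Σ< K n (λ t → u (j ℕ.+ t))) →
    (∀ j → j ℕ.< r → v (n ℕ.+ j) ≈ Σ< K n (λ t → v (j ℕ.+ t))) →
    (∀ t → t ℕ.< n → u t ≈ v t) →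
    ∀ k → k ℕ.< n ℕ.+ r → u k ≈ v k
  recurrence-agree n r u v u-rec v-rec initial = <-rec _ step
    where
    step : ∀ k → (∀ {i} → i ℕ.< k → i ℕ.< n ℕ.+ r → u i ≈ v i) → k ℕ.< n ℕ.+ r → u k ≈ v k
    step k ih k<n+r with k <? n
    ... | yes k<n = initial k k<n
    ... | no k≮n with m≤n⇒∃[o]m+o≡n (≮⇒≥ k≮n)
    ...   | j , ≡.refl = begin
      u (n ℕ.+ j)                     ≈⟨ u-rec j j<r ⟩
      Σ< K n (λ t → u (j ℕ.+ t))     ≈⟨ Σ<-cong n (λ t t<n → ih (j+t<n+j t<n) (<-≤-trans (j+t<n+j t<n) (<⇒≤ k<n+r))) ⟩
      Σ< K n (λ t → v (j ℕ.+ t))     ≈⟨ v-rec j j<r ⟨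
      v (n ℕ.+ j)                     ∎
      where
      j<r = +-cancelˡ-< n j r k<n+r
      j+t<n+j : ∀ {t} → t ℕ.< n → j ℕ.+ t ℕ.< n ℕ.+ j
      j+t<n+j {t} t<n = ≡.subst (j ℕ.+ t ℕ.<_) (ℕ-+-comm j n) (+-monoʳ-< j t<n)

  fromℕ-+ : ∀ a b → fromℕ K (a ℕ.+ b) ≈ fromℕ K a + fromℕ K b
  fromℕ-+ zero    b = sym (+-identityˡ _)
  fromℕ-+ (suc a) b = trans (+-congˡ (fromℕ-+ a b)) (sym (+-assoc _ _ _))

  Σ<-fromℕ : ∀ n j (g : ℕ → ℕ) d →
             Σ< K n (λ t → fromℕ K (g (j ℕ.+ t)) * d) ≈ fromℕ K (sum (take n (applyDownFrom g (n ℕ.+ j)))) * d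
  Σ<-fromℕ zero    j g d = sym (zeroˡ d)
  Σ<-fromℕ (suc n) j g d = begin
    Σ< K n (λ t → fromℕ K (g (j ℕ.+ t)) * d) + fromℕ K (g (j ℕ.+ n)) * d
      ≈⟨ +-cong (Σ<-fromℕ n j g d) (reflexive (≡.cong (λ k → fromℕ K (g k) * d) (ℕ-+-comm j n))) ⟩
    fromℕ K S * d + fromℕ K (g (n ℕ.+ j)) * d   ≈⟨ distribʳ d _ _ ⟨
    (fromℕ K S + fromℕ K (g (n ℕ.+ j))) * d     ≈⟨ *-congʳ (+-comm _ _) ⟩
    (fromℕ K (g (n ℕ.+ j)) + fromℕ K S) * d     ≈⟨ *-congʳ (fromℕ-+ (g (n ℕ.+ j)) S) ⟨
    fromℕ K (g (n ℕ.+ j) ℕ.+ S) * d             ∎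
    where S = sum (take n (applyDownFrom g (n ℕ.+ j)))

module SelectedMinor {c ℓ} (K : CommutativeRing c ℓ) where
  open import Data.Nat using (ℕ; zero; suc; s≤s)
  import Data.Nat as ℕ
  open import Data.Nat.Properties using (m≤n⇒m≤1+n; m≤n⇒m<n∨m≡n)
  open import Data.Fin using (Fin; zero; suc; toℕ; fromℕ<)
  import Data.Fin as Fin
  open import Data.Fin.Properties using (toℕ-fromℕ; toℕ-fromℕ<)
  open import Data.Sum using (inj₁; inj₂)
  open import Data.Vec.Functional using (Vector; tail)
  open import Data.Vec.Functional.Properties using (updateAt-id-local)
  open import Function using (_∘_)
  open import Relation.Binary.PropositionalEquality as ≡ using (_≡_)
  open CommutativeRing K hiding (zero)
  open import Relation.Binary.Reasoning.Setoid setoid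
  open Determinant K
  open Recurrence K
  open ShiftedF

  selectCol-≔ : ∀ {h} m r (A : Vector (Vector Carrier h) (suc m)) (B : ℕ → Vector Carrier h) →
                (∀ j i → B (toℕ j) i ≈ A j i) → ∀ j i → B (selectCol m r j) i ≈ (A [ Fin.fromℕ m ]≔ B (m ℕ.+ r)) j i
  selectCol-≔ zero    r A B B≈A zero    i = refl
  selectCol-≔ (suc m) r A B B≈A zero    i = B≈A zero i
  selectCol-≔ (suc m) r A B B≈A (suc j) i = selectCol-≔ m r (tail A) (B ∘ suc) (B≈A ∘ suc) j i

  module Columns {m} (A : Matrix (suc m)) (B : ℕ → Vector Carrier (suc m)) (B≈A : ∀ j i → B (toℕ j) i ≈ A j i) where

    D : Vector Carrier (suc m) → Carrier
    D v = Det (A [ Fin.fromℕ m ]≔ v)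

    G : ℕ → ℕ
    G = Fshift (suc m) m

    B≈A-at : ∀ {k} (j : Fin (suc m)) → toℕ j ≡ k → ∀ i → B k i ≈ A j i
    B≈A-at j ≡.refl = B≈A j

    D∘B-initial : ∀ t → t ℕ.< suc m → D (B t) ≈ fromℕ K (G t) * Det A
    D∘B-initial t (s≤s t≤m) with m≤n⇒m<n∨m≡n t≤m
    ... | inj₁ t<m = begin
      D (B t)               ≈⟨ det-≔-cong A (Fin.fromℕ m) (B≈A-at p (toℕ-fromℕ< t<1+m)) ⟩
      D (A p)               ≈⟨ det-≔-copy A p<last ⟩
      0#                    ≈⟨ zeroˡ (Det A) ⟨
      0# * Det A            ≈⟨ *-congʳ (reflexive (≡.cong (fromℕ K) (Fshift-< (suc m) t<m))) ⟨
      fromℕ K (G t) * Det A ∎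
      where
      t<1+m = m≤n⇒m≤1+n t<m
      p = fromℕ< t<1+m
      p<last = ≡.subst₂ ℕ._<_ (≡.sym (toℕ-fromℕ< t<1+m)) (≡.sym (toℕ-fromℕ m)) t<m
    ... | inj₂ ≡.refl = begin
      D (B m)               ≈⟨ det-≔-cong A (Fin.fromℕ m) (B≈A-at (Fin.fromℕ m) (toℕ-fromℕ m)) ⟩
      D (A (Fin.fromℕ m))   ≈⟨ det-cong (λ j i → reflexive (≡.cong-app (updateAt-id-local (Fin.fromℕ m) A ≡.refl j) i)) ⟩
      Det A                 ≈⟨ *-identityˡ (Det A) ⟨
      1# * Det A            ≈⟨ *-congʳ (+-identityʳ 1#) ⟨
      (1# + 0#) * Det A     ≈⟨ *-congʳ (reflexive (≡.cong (fromℕ K) (Fshift-self (suc m) m))) ⟨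
      fromℕ K (G m) * Det A ∎

    D∘B-closed-form : ∀ r → (∀ j → j ℕ.< r → ∀ i → B (suc m ℕ.+ j) i ≈ Σ< K (suc m) (λ t → B (j ℕ.+ t) i)) →
                      ∀ k → k ℕ.< suc m ℕ.+ r → D (B k) ≈ fromℕ K (G k) * Det A
    D∘B-closed-form r B-rec = recurrence-agree (suc m) r (D ∘ B) (λ k → fromℕ K (G k) * Det A)
      (λ j j<r → trans (det-≔-cong A (Fin.fromℕ m) (B-rec j j<r)) (det-Σ< A (Fin.fromℕ m) (suc m) (λ t → B (j ℕ.+ t))))
      (λ j _ → trans (reflexive (≡.cong (λ x → fromℕ K x * Det A) (Fshift-recurrence m j)))
                     (sym (Σ<-fromℕ (suc m) j G (Det A))))
      D∘B-initial

open import Level using (Level)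
open import Data.Nat using (ℕ; suc; _+_; _<_)
open import Data.Fin using (Fin; toℕ)

mainTheorem1 : ∀ {c ℓ : Level} (K : CommutativeRing c ℓ) → IsField K →
    (m r' : ℕ) →
    (A : Fin (suc m) → Fin (suc m) → CommutativeRing.Carrier K) →
    (B : ℕ → Fin (suc m) → CommutativeRing.Carrier K) →
    (∀ (j : Fin (suc m)) (i : Fin (suc m)) → CommutativeRing._≈_ K (B (toℕ j) i) (A j i)) →
    (∀ (j : ℕ) → j < suc r' → ∀ (i : Fin (suc m)) →
      CommutativeRing._≈_ K (B (suc m + j) i) (Σ< K (suc m) (λ t → B (j + t) i))) →
    CommutativeRing._≈_ K
      (det K (suc m) (λ j i → B (selectCol m (suc r') j) i))
      (CommutativeRing._*_ K (fromℕ K (F (suc m) (suc r'))) (det K (suc m) A))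
mainTheorem1 K _ m r′ A B B≈A B-rec = begin
  det K (suc m) (λ j i → B (selectCol m (suc r′) j) i)  ≈⟨ det-cong (selectCol-≔ m (suc r′) A B B≈A) ⟩
  D (B (m + suc r′))                                     ≈⟨ D∘B-closed-form (suc r′) B-rec (m + suc r′) ≤-refl ⟩
  fromℕ K (G (m + suc r′)) * det K (suc m) A             ≈⟨ *-congʳ (reflexive (cong (fromℕ K) (Fshift-+ (suc m) m (suc r′)))) ⟩
  fromℕ K (F (suc m) (suc r′)) * det K (suc m) A         ∎
  where
  open import Data.Nat.Properties using (≤-refl)
  open import Relation.Binary.PropositionalEquality using (cong)
  open CommutativeRing K using (_*_; *-congʳ; reflexive; setoid)
  open import Relation.Binary.Reasoning.Setoid setoid
  open Determinant K using (det-cong)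
  open SelectedMinor K
  open Columns A B B≈A
  open ShiftedF using (Fshift-+)
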